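{- Let $H$ be a strictly $2$-balanced graph with at least five edges and $m_2(H) > 1$. Then for any two edges $e, f \in E(H)$, the graph $H - \{e,f\}$ contains two edges which are vertex-disjoint.
   Context: For a graph $J$, $d_2(J) = \frac{e(J)-1}{v(J)-2}$ if $e(J)\ge 1$ and $v(J)\ge 3$, $d_2(K_2) = 1/2$, and $d_2(J)=0$ otherwise; $m_2(H) = \max\{d_2(J) : J \subseteq H\}$. $H$ is strictly $2$-balanced if $d_2(J) < d_2(H)$ for every proper subgraph $J \subsetneq H$. -}

module Defs where

open import Data.Nat using (ℕ; zero; suc; _<_; _≤_)
open import Data.Integer using (+_)
open import Data.Rational using (ℚ; 0ℚ; ½; _/_)
import Data.Rational as ℚ
open import Data.Fin using (Fin)
import Data.Fin as Fin
open import Data.Fin.Subset using (Subset; _∈_; ∣_∣)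
open import Data.List using (List; length)
import Data.List.Membership.Propositional as L
open import Data.List.Relation.Unary.All using (All)
open import Data.List.Relation.Unary.Unique.Propositional using (Unique)
open import Data.Product using (_×_; Σ; _,_; proj₁; proj₂)
open import Data.Sum using (_⊎_)
open import Relation.Binary.PropositionalEquality using (_≡_)
open import Relation.Nullary using (¬_)

Edge : ℕ → Set
Edge n = Σ (Fin n × Fin n) λ p → proj₁ p Fin.< proj₂ p

ends : ∀ {n} → Edge n → Fin n × Fin n
ends = proj₁

record Graph : Set where
  field
    n      : ℕ
    edges  : List (Edge n)
    unique : Unique edges
open Graph public

v : Graph → ℕ
v H = n H

e : Graph → ℕ
e H = length (edges H)

-- d₂ as a function of (number of vertices, number of edges).
d₂ : ℕ → ℕ → ℚ
d₂ _ zero = 0ℚ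
d₂ zero (suc _) = 0ℚ
d₂ (suc zero) (suc _) = 0ℚ
d₂ (suc (suc zero)) (suc zero) = ½          -- K₂
d₂ (suc (suc zero)) (suc (suc _)) = 0ℚ      -- impossible for simple graphs
d₂ (suc (suc (suc k))) (suc e') = (+ e') / suc k   -- (e-1)/(v-2)

record Subgraph (H : Graph) : Set where
  field
    S      : Subset (n H)
    F      : List (Edge (n H))
    F⊆E    : ∀ x → x L.∈ F → x L.∈ edges H
    F-uniq : Unique F
    F-ends : All (λ x → (proj₁ (ends x) ∈ S) × (proj₂ (ends x) ∈ S)) F
open Subgraph public

vS : ∀ {H} → Subgraph H → ℕ
vS J = ∣ S J ∣

eS : ∀ {H} → Subgraph H → ℕ
eS J = length (F J)

d₂S : ∀ {H} → Subgraph H → ℚ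
d₂S J = d₂ (vS J) (eS J)

-- J is a proper subgraph of H (J ≠ H): it misses a vertex or an edge.
Proper : ∀ {H} → Subgraph H → Set
Proper {H} J = (vS J < v H) ⊎ (eS J < e H)

IsM₂ : Graph → ℚ → Set
IsM₂ H r = Σ (Subgraph H) (λ J → d₂S J ≡ r) × (∀ (J : Subgraph H) → d₂S J ℚ.≤ r)

StrictlyTwoBalanced : Graph → Set
StrictlyTwoBalanced H = ∀ (J : Subgraph H) → Proper J → d₂S J ℚ.< d₂ (v H) (e H)

Disjoint : ∀ {n} → Edge n → Edge n → Set
Disjoint x y =
  ¬ (proj₁ (ends x) ≡ proj₁ (ends y)) × ¬ (proj₁ (ends x) ≡ proj₂ (ends y)) ×
  ¬ (proj₂ (ends x) ≡ proj₁ (ends y)) × ¬ (proj₂ (ends x) ≡ proj₂ (ends y))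

{-# OPTIONS --safe #-}
module Submission where

-- Since H is strictly 2-balanced, H itself attains m₂(H), so d₂(H) > 1: H has v ≥ 4 vertices and
-- e ≥ v edges. Deleting a vertex of degree
-- at most 1 would leave a subgraph at least as dense as H, so every vertex has degree at least 2;
-- and a triangle (d₂ = 2) would be denser than H as soon as e ≤ v + 1.
-- Suppose the at least three edges of H other than x and y pairwise intersect. Then either they
-- lie in a triangle, so e ≤ 3 + 2 ≤ v + 1; or they form a star with centre s, so e ≤ (v − 1) + 2.
-- In the star case every leaf has a second edge, which can only be x or y; two of the three
-- leaves share it, and with the centre they span a triangle.

open import Defs
open import Data.Empty using (⊥; ⊥-elim)
open import Data.Fin as Fin using (Fin)
open import Data.Fin.Patterns using (0F; 1F; 2F)
import Data.Fin.Properties as Finₚ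
open import Data.Fin.Subset as Sub using (Subset; ⁅_⁆; _∪_; ∁; ⊤; inside; outside)
import Data.Fin.Subset.Properties as Subₚ
open import Data.Vec.Base using (_∷_; here; there)
open import Data.Integer as ℤ using (+_; +<+)
import Data.Integer.Properties as ℤₚ
open import Data.List using (List; []; _∷_; length; filter; allFin)
import Data.List.Properties as Listₚ
open import Data.List.Membership.Propositional using (_∈_; find; lose)
open import Data.List.Membership.Propositional.Properties using (∈-filter⁺; ∈-filter⁻; ∈-allFin)
open import Data.List.Relation.Binary.Subset.Propositional using (_⊆_)
open import Data.List.Relation.Unary.All as All using ([]; _∷_)
open import Data.List.Relation.Unary.AllPairs using ([]; _∷_)
open import Data.List.Relation.Unary.Any using (here; there; any?)
open import Data.List.Relation.Unary.Unique.Propositional using (Unique)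
open import Data.List.Relation.Unary.Unique.Propositional.Properties using (filter⁺)
open import Data.Nat as ℕ using (ℕ; zero; suc; _+_; _*_; _∸_; _≤_; z≤n; s≤s; _<?_)
import Data.Nat.Properties as ℕₚ
open import Data.Product using (Σ; ∃; ∃₂; _×_; _,_; proj₁; proj₂)
import Data.Product.Properties as Productₚ
open import Data.Rational as ℚ using (0ℚ; 1ℚ; ½; _<_; *<*)
import Data.Rational.Properties as ℚₚ
import Data.Rational.Unnormalised as ℚᵘ
import Data.Rational.Unnormalised.Properties as ℚᵘₚ
open import Data.Sum as Sum using (_⊎_; inj₁; inj₂; [_,_]′)
open import Function using (_∘_; id)
open import Relation.Binary.Definitions using (DecidableEquality)
open import Relation.Binary.PropositionalEquality
open import Relation.Nullary using (¬_; Dec; yes; no; ¬?; contradiction)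
open import Relation.Nullary.Decidable using (_×-dec_; _⊎-dec_; decidable-stable)
open import Relation.Unary using (Decidable)
open import Relation.Unary.Properties using (∁?)

private
  variable
    A B : Set
    m : ℕ

length-≤-by-injection : {xs : List A} {ys : List B} (f : A → B) → DecidableEquality B → Unique xs →
  (∀ {a b} → a ∈ xs → b ∈ xs → f a ≡ f b → a ≡ b) →
  (∀ {a} → a ∈ xs → f a ∈ ys) → length xs ≤ length ys
length-≤-by-injection {xs = []} f _≟_ _ _ _ = z≤n
length-≤-by-injection {xs = x ∷ xs} {ys = ys} f _≟_ (x∉xs ∷ xs!) f-inj f-into = begin-strict
  length xs                  ≤⟨ length-≤-by-injection f _≟_ xs! (λ a∈ b∈ → f-inj (there a∈) (there b∈)) into-rest ⟩
  length (filter ≢fx? ys)    <⟨ Listₚ.filter-notAll ≢fx? ys (lose (f-into (here refl)) λ fx≢fx → fx≢fx refl) ⟩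
  length ys                  ∎
  where
  open ℕₚ.≤-Reasoning
  ≢fx? = λ b → ¬? (b ≟ f x)
  into-rest : ∀ {a} → a ∈ xs → f a ∈ filter ≢fx? ys
  into-rest a∈xs = ∈-filter⁺ ≢fx? (f-into (there a∈xs))
    λ fa≡fx → All.lookup x∉xs a∈xs (f-inj (here refl) (there a∈xs) (sym fa≡fx))

length-≤-of-⊆ : {xs ys : List A} → DecidableEquality A → Unique xs → xs ⊆ ys → length xs ≤ length ys
length-≤-of-⊆ _≟_ xs! xs⊆ys = length-≤-by-injection id _≟_ xs! (λ _ _ → id) xs⊆ys

length-filter+length-filter-∁ : {P : A → Set} (P? : Decidable P) (xs : List A) →
  length (filter P? xs) + length (filter (∁? P?) xs) ≡ length xs
length-filter+length-filter-∁ P? [] = refl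
length-filter+length-filter-∁ P? (x ∷ xs) with P? x
... | yes _ = cong suc (length-filter+length-filter-∁ P? xs)
... | no _  = trans (ℕₚ.+-suc _ _) (cong suc (length-filter+length-filter-∁ P? xs))

three-distinct : {xs : List A} → Unique xs → 3 ≤ length xs →
  ∃ λ a → ∃₂ λ b c → a ∈ xs × b ∈ xs × c ∈ xs × a ≢ b × a ≢ c × b ≢ c
three-distinct {xs = a ∷ b ∷ c ∷ _} ((a≢b ∷ a≢c ∷ _) ∷ (b≢c ∷ _) ∷ _) _ =
  a , b , c , here refl , there (here refl) , there (there (here refl)) , a≢b , a≢c , b≢c
three-distinct {xs = []}         _ ()
three-distinct {xs = _ ∷ []}     _ (s≤s ())
three-distinct {xs = _ ∷ _ ∷ []} _ (s≤s (s≤s ()))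

d₂-<⇒*-< : ∀ a b c d → d₂ (3 + a) (suc b) < d₂ (3 + c) (suc d) → b * suc c ℕ.< d * suc a
d₂-<⇒*-< a b c d lt with ℚᵘₚ.<-respʳ-≃ (ℚₚ.toℚᵘ-fromℚᵘ (ℚᵘ.mkℚᵘ (+ d) c))
                          (ℚᵘₚ.<-respˡ-≃ (ℚₚ.toℚᵘ-fromℚᵘ (ℚᵘ.mkℚᵘ (+ b) a)) (ℚₚ.toℚᵘ-mono-< lt))
... | ℚᵘ.*<* bc<da =
  ℤₚ.drop‿+<+ (subst₂ ℤ._<_ (sym (ℤₚ.pos-* b (suc c))) (sym (ℤₚ.pos-* d (suc a))) bc<da)

¬1<0 : ¬ 1ℚ < 0ℚ
¬1<0 (*<* (+<+ ()))

¬1<½ : ¬ 1ℚ < ½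
¬1<½ (*<* (+<+ (s≤s ())))

1<d₂⇒3≤v≤e : ∀ v e → 1ℚ < d₂ v e → 3 ≤ v × v ≤ e
1<d₂⇒3≤v≤e _ zero 1<0 = contradiction 1<0 ¬1<0
1<d₂⇒3≤v≤e 0 (suc _) 1<0 = contradiction 1<0 ¬1<0
1<d₂⇒3≤v≤e 1 (suc _) 1<0 = contradiction 1<0 ¬1<0
1<d₂⇒3≤v≤e 2 1 1<½ = contradiction 1<½ ¬1<½
1<d₂⇒3≤v≤e 2 (suc (suc _)) 1<0 = contradiction 1<0 ¬1<0
1<d₂⇒3≤v≤e (suc (suc (suc a))) (suc b) 1<d₂ = s≤s (s≤s (s≤s z≤n)) , s≤s 2+a≤b
  where
  2+a≤b : 2 + a ≤ b
  2+a≤b = subst₂ ℕ._<_ (ℕₚ.+-identityʳ (suc a)) (ℕₚ.*-identityʳ b) (d₂-<⇒*-< 0 1 a b 1<d₂)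

d₂-vertex-deletion-≮ : ∀ {v e f} → 4 ≤ v → v ≤ e → e ≤ suc f → ¬ d₂ (v ∸ 1) f < d₂ v e
d₂-vertex-deletion-≮ {suc (suc (suc (suc k)))} {suc e₀} {suc f₀}
                     (s≤s (s≤s (s≤s (s≤s _)))) (s≤s 3+k≤e₀) (s≤s e₀≤1+f₀) lt =
  ℕₚ.<⇒≱ (d₂-<⇒*-< k f₀ (suc k) e₀ lt) (begin
    e₀ * suc k            ≤⟨ ℕₚ.*-monoˡ-≤ (suc k) e₀≤1+f₀ ⟩
    suc k + f₀ * suc k    ≤⟨ ℕₚ.+-monoˡ-≤ (f₀ * suc k) 1+k≤f₀ ⟩
    f₀ + f₀ * suc k       ≡⟨ ℕₚ.*-suc f₀ (suc k) ⟨
    f₀ * suc (suc k)      ∎)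
  where
  open ℕₚ.≤-Reasoning
  1+k≤f₀ : suc k ≤ f₀
  1+k≤f₀ = ℕₚ.≤-pred (ℕₚ.≤-trans (ℕₚ.n≤1+n _) (ℕₚ.≤-trans 3+k≤e₀ e₀≤1+f₀))
d₂-vertex-deletion-≮ {suc (suc (suc (suc _)))} {suc _} {zero}
                     (s≤s (s≤s (s≤s (s≤s _)))) (s≤s (s≤s _)) (s≤s ()) _

d₂-triangle-≮ : ∀ {v e} → 4 ≤ v → e ≤ suc v → ¬ d₂ 3 3 < d₂ v e
d₂-triangle-≮ {suc (suc (suc (suc _)))} {zero} _ _ (*<* (+<+ ()))
d₂-triangle-≮ {suc (suc (suc (suc k)))} {suc e} (s≤s (s≤s (s≤s (s≤s _)))) (s≤s e≤4+k) lt =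
  ℕₚ.<⇒≱ (d₂-<⇒*-< 0 2 (suc k) e lt) (begin
    e * 1              ≡⟨ ℕₚ.*-identityʳ e ⟩
    e                  ≤⟨ e≤4+k ⟩
    4 + k              ≤⟨ ℕₚ.+-monoʳ-≤ 4 (ℕₚ.m≤m+n k (k + 0)) ⟩
    2 * 2 + 2 * k      ≡⟨ ℕₚ.*-distribˡ-+ 2 2 k ⟨
    2 * (2 + k)        ∎)
  where open ℕₚ.≤-Reasoning

lo hi : Edge m → Fin m
lo = proj₁ ∘ ends
hi = proj₂ ∘ ends

lo≢hi : (g : Edge m) → lo g ≢ hi g
lo≢hi (_ , lo<hi) = Finₚ.<⇒≢ lo<hi

Edge-≡ : {g h : Edge m} → lo g ≡ lo h → hi g ≡ hi h → g ≡ h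
Edge-≡ {g = (a , b) , p} {(.a , .b) , q} refl refl = cong ((a , b) ,_) (Finₚ.<-irrelevant p q)

_≟ᵉ_ : DecidableEquality (Edge m)
_≟ᵉ_ = Productₚ.≡-dec (Productₚ.≡-dec Fin._≟_ Fin._≟_) λ p q → yes (Finₚ.<-irrelevant p q)

infix 4 _∈ᵥ_ _∈ᵥ?_

data _∈ᵥ_ (w : Fin m) (g : Edge m) : Set where
  at-lo : w ≡ lo g → w ∈ᵥ g
  at-hi : w ≡ hi g → w ∈ᵥ g

_∈ᵥ?_ : (w : Fin m) (g : Edge m) → Dec (w ∈ᵥ g)
w ∈ᵥ? g with w Fin.≟ lo g | w Fin.≟ hi g
... | yes w≡lo | _        = yes (at-lo w≡lo)
... | no _     | yes w≡hi = yes (at-hi w≡hi)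
... | no w≢lo  | no w≢hi  = no λ { (at-lo w≡lo) → w≢lo w≡lo ; (at-hi w≡hi) → w≢hi w≡hi }

-- The junk value lo g when w is not an endpoint of g.
opposite : Fin m → Edge m → Fin m
opposite w g with lo g Fin.≟ w
... | yes _ = hi g
... | no  _ = lo g

opposite-∈ᵥ : (w : Fin m) (g : Edge m) → opposite w g ∈ᵥ g
opposite-∈ᵥ w g with lo g Fin.≟ w
... | yes _ = at-hi refl
... | no  _ = at-lo refl

opposite-≢ : (w : Fin m) (g : Edge m) → opposite w g ≢ w
opposite-≢ w g with lo g Fin.≟ w
... | yes lo≡w = λ hi≡w → lo≢hi g (trans lo≡w (sym hi≡w))
... | no  lo≢w = lo≢w

module _ {w : Fin m} {g : Edge m} where

  ∈ᵥ⇒≡∨≡opposite : w ∈ᵥ g → ∀ {u} → u ∈ᵥ g → u ≡ w ⊎ u ≡ opposite w g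
  ∈ᵥ⇒≡∨≡opposite w∈g u∈g with lo g Fin.≟ w
  ∈ᵥ⇒≡∨≡opposite _            (at-lo u≡lo) | yes lo≡w = inj₁ (trans u≡lo lo≡w)
  ∈ᵥ⇒≡∨≡opposite _            (at-hi u≡hi) | yes _    = inj₂ u≡hi
  ∈ᵥ⇒≡∨≡opposite _            (at-lo u≡lo) | no  _    = inj₂ u≡lo
  ∈ᵥ⇒≡∨≡opposite (at-lo w≡lo) (at-hi _)    | no  lo≢w = contradiction (sym w≡lo) lo≢w
  ∈ᵥ⇒≡∨≡opposite (at-hi w≡hi) (at-hi u≡hi) | no  _    = inj₁ (trans u≡hi (sym w≡hi))

  ∈ᵥ∧≢⇒≡opposite : w ∈ᵥ g → ∀ {u} → u ∈ᵥ g → u ≢ w → u ≡ opposite w g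
  ∈ᵥ∧≢⇒≡opposite w∈g u∈g u≢w =
    [ (λ u≡w → contradiction u≡w u≢w) , id ]′ (∈ᵥ⇒≡∨≡opposite w∈g u∈g)

endpoints-⊆⇒≡ : {g h : Edge m} → (∀ {u} → u ∈ᵥ g → u ∈ᵥ h) → g ≡ h
endpoints-⊆⇒≡ {g = g} {h} g⊆h with g⊆h (at-lo refl) | g⊆h (at-hi refl)
... | at-lo lo≡lo | at-lo hi≡lo = contradiction (trans lo≡lo (sym hi≡lo)) (lo≢hi g)
... | at-lo lo≡lo | at-hi hi≡hi = Edge-≡ lo≡lo hi≡hi
... | at-hi lo≡hi | at-lo hi≡lo =
  contradiction (subst₂ Fin._<_ lo≡hi hi≡lo (proj₂ g)) (Finₚ.<-asym (proj₂ h))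
... | at-hi lo≡hi | at-hi hi≡hi = contradiction (trans lo≡hi (sym hi≡hi)) (lo≢hi g)

opposite-injective : {w : Fin m} {g h : Edge m} →
  w ∈ᵥ g → w ∈ᵥ h → opposite w g ≡ opposite w h → g ≡ h
opposite-injective {w = w} {g} {h} w∈g w∈h o≡o = endpoints-⊆⇒≡ λ u∈g →
  [ (λ u≡w → subst (_∈ᵥ h) (sym u≡w) w∈h)
  , (λ u≡o → subst (_∈ᵥ h) (sym (trans u≡o o≡o)) (opposite-∈ᵥ w h))
  ]′ (∈ᵥ⇒≡∨≡opposite w∈g u∈g)

two-common-endpoints⇒≡ : {u u′ : Fin m} {g h : Edge m} → u ≢ u′ →
  u ∈ᵥ g → u′ ∈ᵥ g → u ∈ᵥ h → u′ ∈ᵥ h → g ≡ h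
two-common-endpoints⇒≡ u≢u′ u∈g u′∈g u∈h u′∈h = opposite-injective u∈g u∈h
  (trans (sym (∈ᵥ∧≢⇒≡opposite u∈g u′∈g (u≢u′ ∘ sym))) (∈ᵥ∧≢⇒≡opposite u∈h u′∈h (u≢u′ ∘ sym)))

∈ᵥ-between : {u u′ z : Fin m} {g : Edge m} → u ≢ u′ → u ∈ᵥ g → u′ ∈ᵥ g → z ∈ᵥ g → z ≡ u ⊎ z ≡ u′
∈ᵥ-between u≢u′ u∈g u′∈g z∈g =
  Sum.map₂ (λ z≡o → trans z≡o (sym (∈ᵥ∧≢⇒≡opposite u∈g u′∈g (u≢u′ ∘ sym)))) (∈ᵥ⇒≡∨≡opposite u∈g z∈g)

Disjoint? : (g h : Edge m) → Dec (Disjoint g h)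
Disjoint? g h =
  ¬? (lo g Fin.≟ lo h) ×-dec ¬? (lo g Fin.≟ hi h) ×-dec ¬? (hi g Fin.≟ lo h) ×-dec ¬? (hi g Fin.≟ hi h)

¬Disjoint⇒common-endpoint : {g h : Edge m} → ¬ Disjoint g h → ∃ λ w → w ∈ᵥ g × w ∈ᵥ h
¬Disjoint⇒common-endpoint {g = g} {h} ¬g∥h
  with lo g Fin.≟ lo h | lo g Fin.≟ hi h | hi g Fin.≟ lo h | hi g Fin.≟ hi h
... | yes p | _     | _     | _     = lo g , at-lo refl , at-lo p
... | no _  | yes p | _     | _     = lo g , at-lo refl , at-hi p
... | no _  | no _  | yes p | _     = hi g , at-hi refl , at-lo p
... | no _  | no _  | no _  | yes p = hi g , at-hi refl , at-hi p
... | no p₁ | no p₂ | no p₃ | no p₄ = contradiction (p₁ , p₂ , p₃ , p₄) ¬g∥h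

K₃-edges : List (Edge 3)
K₃-edges = ((0F , 1F) , s≤s z≤n) ∷ ((0F , 2F) , s≤s z≤n) ∷ ((1F , 2F) , s≤s (s≤s z≤n)) ∷ []

∈-K₃-edges : (g : Edge 3) → g ∈ K₃-edges
∈-K₃-edges ((0F , 1F) , _) = here (Edge-≡ refl refl)
∈-K₃-edges ((0F , 2F) , _) = there (here (Edge-≡ refl refl))
∈-K₃-edges ((1F , 2F) , _) = there (there (here (Edge-≡ refl refl)))
∈-K₃-edges ((0F , 0F) , ())
∈-K₃-edges ((1F , 0F) , ())
∈-K₃-edges ((1F , 1F) , s≤s ())
∈-K₃-edges ((2F , 0F) , ())
∈-K₃-edges ((2F , 1F) , s≤s ())
∈-K₃-edges ((2F , 2F) , s≤s (s≤s ()))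

∣⁅x⁆∪p∣≡1+∣p∣ : {x : Fin m} {p : Subset m} → x Sub.∉ p → Sub.∣ ⁅ x ⁆ ∪ p ∣ ≡ suc Sub.∣ p ∣
∣⁅x⁆∪p∣≡1+∣p∣ {x = Fin.zero}  {outside ∷ p} _   = cong (suc ∘ Sub.∣_∣) (Subₚ.∪-identityˡ p)
∣⁅x⁆∪p∣≡1+∣p∣ {x = Fin.zero}  {inside ∷ p}  x∉p = contradiction here x∉p
∣⁅x⁆∪p∣≡1+∣p∣ {x = Fin.suc x} {outside ∷ p} x∉p = ∣⁅x⁆∪p∣≡1+∣p∣ (x∉p ∘ there)
∣⁅x⁆∪p∣≡1+∣p∣ {x = Fin.suc x} {inside ∷ p}  x∉p = cong suc (∣⁅x⁆∪p∣≡1+∣p∣ (x∉p ∘ there))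

∣⁅x⁆∪⁅y⁆∪⁅z⁆∣≡3 : {x y z : Fin m} → x ≢ y → x ≢ z → y ≢ z → Sub.∣ ⁅ x ⁆ ∪ (⁅ y ⁆ ∪ ⁅ z ⁆) ∣ ≡ 3
∣⁅x⁆∪⁅y⁆∪⁅z⁆∣≡3 {x = x} {y} {z} x≢y x≢z y≢z = begin
  Sub.∣ ⁅ x ⁆ ∪ (⁅ y ⁆ ∪ ⁅ z ⁆) ∣ ≡⟨ ∣⁅x⁆∪p∣≡1+∣p∣ x∉⁅y,z⁆ ⟩
  suc Sub.∣ ⁅ y ⁆ ∪ ⁅ z ⁆ ∣ ≡⟨ cong suc (∣⁅x⁆∪p∣≡1+∣p∣ (Subₚ.x≢y⇒x∉⁅y⁆ y≢z)) ⟩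
  suc (suc Sub.∣ ⁅ z ⁆ ∣)   ≡⟨ cong (suc ∘ suc) (Subₚ.∣⁅x⁆∣≡1 z) ⟩
  3                         ∎
  where
  open ≡-Reasoning
  x∉⁅y,z⁆ = [ Subₚ.x≢y⇒x∉⁅y⁆ x≢y , Subₚ.x≢y⇒x∉⁅y⁆ x≢z ]′ ∘ Subₚ.x∈p∪q⁻ ⁅ y ⁆ ⁅ z ⁆

∈⁅x⁆∪⁅y⁆∪⁅z⁆ : {x y z u : Fin m} → u ≡ x ⊎ u ≡ y ⊎ u ≡ z → u Sub.∈ ⁅ x ⁆ ∪ (⁅ y ⁆ ∪ ⁅ z ⁆)
∈⁅x⁆∪⁅y⁆∪⁅z⁆ (inj₁ refl)        = Subₚ.x∈p∪q⁺ (inj₁ (Subₚ.x∈⁅x⁆ _))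
∈⁅x⁆∪⁅y⁆∪⁅z⁆ (inj₂ (inj₁ refl)) = Subₚ.x∈p∪q⁺ (inj₂ (Subₚ.x∈p∪q⁺ (inj₁ (Subₚ.x∈⁅x⁆ _))))
∈⁅x⁆∪⁅y⁆∪⁅z⁆ (inj₂ (inj₂ refl)) = Subₚ.x∈p∪q⁺ (inj₂ (Subₚ.x∈p∪q⁺ (inj₂ (Subₚ.x∈⁅x⁆ _))))

module _ (H : Graph) where

  subgraph : (X : Subset (n H)) (L : List (Edge (n H))) → Unique L → L ⊆ edges H →
             (∀ {t} → t ∈ L → ∀ {u} → u ∈ᵥ t → u Sub.∈ X) → Subgraph H
  subgraph X L L! L⊆E L-in-X = record
    { S      = X
    ; F      = L
    ; F⊆E    = λ _ → L⊆E
    ; F-uniq = L!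
    ; F-ends = All.tabulate λ t∈L → L-in-X t∈L (at-lo refl) , L-in-X t∈L (at-hi refl)
    }

  whole : Subgraph H
  whole = subgraph ⊤ (edges H) (unique H) id λ _ _ → Subₚ.∈⊤

  vS-whole : vS whole ≡ v H
  vS-whole = Subₚ.∣⊤∣≡n (n H)

  vS≤v : (J : Subgraph H) → vS J ≤ v H
  vS≤v J = Subₚ.∣p∣≤n (S J)

  eS≤e : (J : Subgraph H) → eS J ≤ e H
  eS≤e J = length-≤-of-⊆ _≟ᵉ_ (F-uniq J) (F⊆E J _)

  ¬Proper⇒same-size : (J : Subgraph H) → ¬ Proper J → vS J ≡ v H × eS J ≡ e H
  ¬Proper⇒same-size J ¬proper =
    ℕₚ.≤-antisym (vS≤v J) (ℕₚ.≮⇒≥ (¬proper ∘ inj₁)) , ℕₚ.≤-antisym (eS≤e J) (ℕₚ.≮⇒≥ (¬proper ∘ inj₂))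

  strictly-balanced⇒m₂≡d₂ : StrictlyTwoBalanced H → ∀ {r} → IsM₂ H r → r ≡ d₂ (v H) (e H)
  strictly-balanced⇒m₂≡d₂ sb {r} ((J , d₂J≡r) , maximal) with (vS J <? v H) ⊎-dec (eS J <? e H)
  ... | yes proper = contradiction (ℚₚ.<-≤-trans (sb J proper) d₂≤r) (ℚₚ.<-irrefl d₂J≡r)
    where
    d₂≤r : d₂ (v H) (e H) ℚ.≤ r
    d₂≤r = subst (λ k → d₂ k (e H) ℚ.≤ r) vS-whole (maximal whole)
  ... | no ¬proper = trans (sym d₂J≡r) (cong₂ d₂ vJ≡v eJ≡e)
    where
    vJ≡v = proj₁ (¬Proper⇒same-size J ¬proper)
    eJ≡e = proj₂ (¬Proper⇒same-size J ¬proper)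

  delete-vertex : Fin (n H) → Subgraph H
  delete-vertex w = subgraph (∁ ⁅ w ⁆) (filter w∉? (edges H)) (filter⁺ w∉? (unique H))
    (proj₁ ∘ ∈-filter⁻ w∉?) avoids-w
    where
    w∉? = ∁? (w ∈ᵥ?_)
    avoids-w : ∀ {t} → t ∈ filter w∉? (edges H) → ∀ {u} → u ∈ᵥ t → u Sub.∈ ∁ ⁅ w ⁆
    avoids-w t∈F u∈t = Subₚ.x∉p⇒x∈∁p λ u∈⁅w⁆ →
      proj₂ (∈-filter⁻ w∉? {xs = edges H} t∈F) (subst (_∈ᵥ _) (Subₚ.x∈⁅y⁆⇒x≡y w u∈⁅w⁆) u∈t)

  vS-delete-vertex : (w : Fin (n H)) → vS (delete-vertex w) ≡ v H ∸ 1
  vS-delete-vertex w = trans (Subₚ.∣∁p∣≡n∸∣p∣ ⁅ w ⁆) (cong (v H ∸_) (Subₚ.∣⁅x⁆∣≡1 w))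

≤3-edges-on-3-vertices : (H : Graph) → v H ≡ 3 → e H ≤ 3
≤3-edges-on-3-vertices record { edges = es ; unique = es! } refl =
  length-≤-of-⊆ _≟ᵉ_ es! λ {g} _ → ∈-K₃-edges g

dense⇒4≤v : (H : Graph) → 5 ≤ e H → 1ℚ < d₂ (v H) (e H) → 4 ≤ v H
dense⇒4≤v H 5≤e 1<d₂ = ℕₚ.≤∧≢⇒< (proj₁ (1<d₂⇒3≤v≤e (v H) (e H) 1<d₂))
  λ 3≡v → ℕₚ.<⇒≱ (ℕₚ.≤-trans (ℕₚ.n≤1+n 4) 5≤e) (≤3-edges-on-3-vertices H (sym 3≡v))

avoids? : (x y : Edge m) (g : Edge m) → Dec (g ≢ x × g ≢ y)
avoids? x y g = ¬? (g ≟ᵉ x) ×-dec ¬? (g ≟ᵉ y)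

length-≤-2+avoiding : (x y : Edge m) {es : List (Edge m)} → Unique es →
  length es ≤ 2 + length (filter (avoids? x y) es)
length-≤-2+avoiding x y {es} es! = begin
  length es                                                   ≡⟨ length-filter+length-filter-∁ (avoids? x y) es ⟨
  length (filter (avoids? x y) es) + length (filter hits? es) ≤⟨ ℕₚ.+-monoʳ-≤ _ hits≤2 ⟩
  length (filter (avoids? x y) es) + 2                        ≡⟨ ℕₚ.+-comm _ 2 ⟩
  2 + length (filter (avoids? x y) es)                        ∎
  where
  open ℕₚ.≤-Reasoning
  hits? = ∁? (avoids? x y)
  hits-⊆-xy : filter hits? es ⊆ x ∷ y ∷ []
  hits-⊆-xy {g} g∈ with g ≟ᵉ x | g ≟ᵉ y
  ... | yes g≡x | _       = here g≡x
  ... | no _    | yes g≡y = there (here g≡y)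
  ... | no g≢x  | no g≢y  = contradiction (g≢x , g≢y) (proj₂ (∈-filter⁻ hits? {xs = es} g∈))
  hits≤2 : length (filter hits? es) ≤ 2
  hits≤2 = length-≤-of-⊆ _≟ᵉ_ (filter⁺ hits? es!) hits-⊆-xy

Intersecting : List (Edge m) → Set
Intersecting R = ∀ {g h} → g ∈ R → h ∈ R → ∃ λ w → w ∈ᵥ g × w ∈ᵥ h

disjoint-pair-or-intersecting : (R : List (Edge m)) →
  (∃₂ λ g h → g ∈ R × h ∈ R × Disjoint g h) ⊎ Intersecting R
disjoint-pair-or-intersecting R with any? (λ g → any? (Disjoint? g) R) R
... | yes found = let g , g∈R , found-h = find found ; h , h∈R , g∥h = find found-h in
  inj₁ (g , h , g∈R , h∈R , g∥h)
... | no none = inj₂ λ g∈R h∈R → ¬Disjoint⇒common-endpoint λ g∥h → none (lose g∈R (lose h∈R g∥h))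

star-length< : {R : List (Edge m)} {s : Fin m} →
  Unique R → (∀ {g} → g ∈ R → s ∈ᵥ g) → length R ℕ.< m
star-length< {m = m} {R} {s} R! star = begin-strict
  length R                        ≤⟨ length-≤-by-injection (opposite s) Fin._≟_ R! leaves-distinct leaf-≢s ⟩
  length (filter ≢s? (allFin m))  <⟨ Listₚ.filter-notAll ≢s? (allFin m) (lose (∈-allFin s) λ s≢s → s≢s refl) ⟩
  length (allFin m)               ≡⟨ Listₚ.length-tabulate id ⟩
  m                               ∎
  where
  open ℕₚ.≤-Reasoning
  ≢s? = ∁? (Fin._≟ s)
  leaves-distinct : ∀ {g h} → g ∈ R → h ∈ R → opposite s g ≡ opposite s h → g ≡ h
  leaves-distinct g∈R h∈R = opposite-injective (star g∈R) (star h∈R)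
  leaf-≢s : ∀ {g} → g ∈ R → opposite s g ∈ filter ≢s? (allFin m)
  leaf-≢s {g} _ = ∈-filter⁺ ≢s? (∈-allFin _) (opposite-≢ s g)

module _ {R : List (Edge m)} (intersecting : Intersecting R) {s : Fin m} where

  meets-opposite : {a g : Edge m} → a ∈ R → g ∈ R → s ∈ᵥ a → ¬ s ∈ᵥ g → opposite s a ∈ᵥ g
  meets-opposite a∈R g∈R s∈a s∉g with intersecting a∈R g∈R
  ... | u , u∈a , u∈g with ∈ᵥ⇒≡∨≡opposite s∈a u∈a
  ...   | inj₁ refl = contradiction u∈g s∉g
  ...   | inj₂ refl = u∈g

  star-or-triangle : {a b : Edge m} → a ∈ R → b ∈ R → a ≢ b → s ∈ᵥ a → s ∈ᵥ b →
    (∀ {g} → g ∈ R → s ∈ᵥ g) ⊎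
    (∃ λ g → g ∈ R × opposite s a ∈ᵥ g × opposite s b ∈ᵥ g × R ⊆ a ∷ b ∷ g ∷ [])
  star-or-triangle {a} {b} a∈R b∈R a≢b s∈a s∈b with any? (∁? (s ∈ᵥ?_)) R
  ... | no none = inj₁ λ {g} g∈R → decidable-stable (s ∈ᵥ? g) λ s∉g → none (lose g∈R s∉g)
  ... | yes some with find some
  ...   | g , g∈R , s∉g = inj₂ (g , g∈R , q∈g , r∈g , R⊆abg)
    where
    q∈g = meets-opposite a∈R g∈R s∈a s∉g
    r∈g = meets-opposite b∈R g∈R s∈b s∉g
    q≢r : opposite s a ≢ opposite s b
    q≢r = a≢b ∘ opposite-injective s∈a s∈b
    R⊆abg : R ⊆ a ∷ b ∷ g ∷ []
    R⊆abg {h} h∈R with s ∈ᵥ? h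
    ... | no s∉h = there (there (here (two-common-endpoints⇒≡ q≢r
                     (meets-opposite a∈R h∈R s∈a s∉h) (meets-opposite b∈R h∈R s∈b s∉h) q∈g r∈g)))
    ... | yes s∈h with intersecting h∈R g∈R
    ...   | u , u∈h , u∈g with ∈ᵥ-between q≢r q∈g r∈g u∈g
    ...     | inj₁ refl = here (two-common-endpoints⇒≡ (opposite-≢ s a ∘ sym) s∈h u∈h s∈a (opposite-∈ᵥ s a))
    ...     | inj₂ refl =
      there (here (two-common-endpoints⇒≡ (opposite-≢ s b ∘ sym) s∈h u∈h s∈b (opposite-∈ᵥ s b)))

module StrictlyBalanced (H : Graph) (sb : StrictlyTwoBalanced H) (4≤v : 4 ≤ v H) (v≤e : v H ≤ e H) where

  -- Minimum degree two: deleting a vertex of degree at most 1 would not lower the density.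
  another-edge-at : (w : Fin (n H)) (t : Edge (n H)) → ∃ λ z → z ∈ edges H × w ∈ᵥ z × z ≢ t
  another-edge-at w t with any? (λ z → (w ∈ᵥ? z) ×-dec ¬? (z ≟ᵉ t)) (edges H)
  ... | yes found = find found
  ... | no none = ⊥-elim (d₂-vertex-deletion-≮ 4≤v v≤e e≤1+e[H-w] d₂[H-w]<d₂[H])
    where
    open ℕₚ.≤-Reasoning
    H-w = delete-vertex H w
    at-w⊆[t] : filter (w ∈ᵥ?_) (edges H) ⊆ t ∷ []
    at-w⊆[t] {z} z∈ with ∈-filter⁻ (w ∈ᵥ?_) {xs = edges H} z∈ | z ≟ᵉ t
    ... | _         | yes z≡t = here z≡t
    ... | z∈E , w∈z | no z≢t  = contradiction (lose z∈E (w∈z , z≢t)) none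
    deg≤1 : length (filter (w ∈ᵥ?_) (edges H)) ≤ 1
    deg≤1 = length-≤-of-⊆ _≟ᵉ_ (filter⁺ (w ∈ᵥ?_) (unique H)) at-w⊆[t]
    e≤1+e[H-w] : e H ≤ suc (eS H-w)
    e≤1+e[H-w] = begin
      e H                                          ≡⟨ length-filter+length-filter-∁ (w ∈ᵥ?_) (edges H) ⟨
      length (filter (w ∈ᵥ?_) (edges H)) + eS H-w  ≤⟨ ℕₚ.+-monoˡ-≤ (eS H-w) deg≤1 ⟩
      suc (eS H-w)                                 ∎
    vS<v : vS H-w ℕ.< v H
    vS<v = subst (ℕ._< v H) (sym (vS-delete-vertex H w))
                 (ℕₚ.∸-monoʳ-< (s≤s z≤n) (ℕₚ.≤-trans (s≤s z≤n) 4≤v))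
    d₂[H-w]<d₂[H] : d₂ (v H ∸ 1) (eS H-w) < d₂ (v H) (e H)
    d₂[H-w]<d₂[H] = subst (λ k → d₂ k (eS H-w) < d₂ (v H) (e H)) (vS-delete-vertex H w) (sb H-w (inj₁ vS<v))

  -- a and b meet at s, and g joins their other endpoints: a triangle, with d₂ = 2.
  no-triangle : e H ≤ suc (v H) → {s : Fin (n H)} {a b g : Edge (n H)} →
    a ∈ edges H → b ∈ edges H → g ∈ edges H → a ≢ b → s ∈ᵥ a → s ∈ᵥ b →
    opposite s a ∈ᵥ g → opposite s b ∈ᵥ g → ⊥
  no-triangle e≤1+v {s} {a} {b} {g} a∈E b∈E g∈E a≢b s∈a s∈b q∈g r∈g =
    d₂-triangle-≮ 4≤v e≤1+v (subst (λ k → d₂ k 3 < d₂ (v H) (e H)) ∣S∣≡3 (sb triangle (inj₂ 3<e)))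
    where
    q = opposite s a
    r = opposite s b
    s≢q : s ≢ q
    s≢q = opposite-≢ s a ∘ sym
    s≢r : s ≢ r
    s≢r = opposite-≢ s b ∘ sym
    q≢r : q ≢ r
    q≢r = a≢b ∘ opposite-injective s∈a s∈b
    a≢g : a ≢ g
    a≢g refl = q≢r (sym (∈ᵥ∧≢⇒≡opposite s∈a r∈g (s≢r ∘ sym)))
    b≢g : b ≢ g
    b≢g refl = q≢r (∈ᵥ∧≢⇒≡opposite s∈b q∈g (s≢q ∘ sym))
    ∣S∣≡3 : Sub.∣ ⁅ s ⁆ ∪ (⁅ q ⁆ ∪ ⁅ r ⁆) ∣ ≡ 3
    ∣S∣≡3 = ∣⁅x⁆∪⁅y⁆∪⁅z⁆∣≡3 s≢q s≢r q≢r
    abg⊆E : a ∷ b ∷ g ∷ [] ⊆ edges H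
    abg⊆E (here refl)                 = a∈E
    abg⊆E (there (here refl))         = b∈E
    abg⊆E (there (there (here refl))) = g∈E
    ends-in-S : ∀ {t} → t ∈ a ∷ b ∷ g ∷ [] → ∀ {u} → u ∈ᵥ t → u Sub.∈ ⁅ s ⁆ ∪ (⁅ q ⁆ ∪ ⁅ r ⁆)
    ends-in-S (here refl)                 u∈a =
      ∈⁅x⁆∪⁅y⁆∪⁅z⁆ ([ inj₁ , inj₂ ∘ inj₁ ]′ (∈ᵥ⇒≡∨≡opposite s∈a u∈a))
    ends-in-S (there (here refl))         u∈b =
      ∈⁅x⁆∪⁅y⁆∪⁅z⁆ ([ inj₁ , inj₂ ∘ inj₂ ]′ (∈ᵥ⇒≡∨≡opposite s∈b u∈b))
    ends-in-S (there (there (here refl))) u∈g =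
      ∈⁅x⁆∪⁅y⁆∪⁅z⁆ (inj₂ (∈ᵥ-between q≢r q∈g r∈g u∈g))
    triangle : Subgraph H
    triangle = subgraph H (⁅ s ⁆ ∪ (⁅ q ⁆ ∪ ⁅ r ⁆)) (a ∷ b ∷ g ∷ [])
      ((a≢b ∷ a≢g ∷ []) ∷ (b≢g ∷ []) ∷ [] ∷ []) abg⊆E ends-in-S
    3<e : 3 ℕ.< e H
    3<e = ℕₚ.≤-trans 4≤v v≤e

  module _ {x y : Edge (n H)} (x∈E : x ∈ edges H) (y∈E : y ∈ edges H) where

    private
      R = filter (avoids? x y) (edges H)

      R⊆E : R ⊆ edges H
      R⊆E = proj₁ ∘ ∈-filter⁻ (avoids? x y)

      R! : Unique R
      R! = filter⁺ (avoids? x y) (unique H)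

      e≤2+|R| : e H ≤ 2 + length R
      e≤2+|R| = length-≤-2+avoiding x y (unique H)

      3≤|R| : 5 ≤ e H → 3 ≤ length R
      3≤|R| 5≤e = ℕₚ.≤-pred (ℕₚ.≤-pred (ℕₚ.≤-trans 5≤e e≤2+|R|))

    module _ {s : Fin (n H)} (star : ∀ {g} → g ∈ R → s ∈ᵥ g) where

      star-sparse : e H ≤ suc (v H)
      star-sparse = ℕₚ.≤-trans e≤2+|R| (s≤s (star-length< R! star))

      leaf-on-x-or-y : {t : Edge (n H)} → t ∈ R → opposite s t ∈ᵥ x ⊎ opposite s t ∈ᵥ y
      leaf-on-x-or-y {t} t∈R with another-edge-at (opposite s t) t
      ... | z , z∈E , l∈z , z≢t with z ≟ᵉ x | z ≟ᵉ y
      ...   | yes refl | _        = inj₁ l∈z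
      ...   | no _     | yes refl = inj₂ l∈z
      ...   | no z≢x   | no z≢y   = contradiction z≡t z≢t
        where
        s∈z = star (∈-filter⁺ (avoids? x y) z∈E (z≢x , z≢y))
        z≡t = two-common-endpoints⇒≡ (opposite-≢ s t ∘ sym) s∈z l∈z (star t∈R) (opposite-∈ᵥ s t)

      two-leaves-on-common-edge : {a b c : Edge (n H)} →
        a ∈ R → b ∈ R → c ∈ R → a ≢ b → a ≢ c → b ≢ c →
        ∃₂ λ t t′ → ∃ λ z → t ∈ R × t′ ∈ R × t ≢ t′ × z ∈ edges H ×
                            opposite s t ∈ᵥ z × opposite s t′ ∈ᵥ z
      two-leaves-on-common-edge a∈R b∈R c∈R a≢b a≢c b≢c
        with leaf-on-x-or-y a∈R | leaf-on-x-or-y b∈R | leaf-on-x-or-y c∈R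
      ... | inj₁ a∼x | inj₁ b∼x | _        = _ , _ , _ , a∈R , b∈R , a≢b , x∈E , a∼x , b∼x
      ... | inj₂ a∼y | inj₂ b∼y | _        = _ , _ , _ , a∈R , b∈R , a≢b , y∈E , a∼y , b∼y
      ... | inj₁ a∼x | inj₂ _   | inj₁ c∼x = _ , _ , _ , a∈R , c∈R , a≢c , x∈E , a∼x , c∼x
      ... | inj₂ a∼y | inj₁ _   | inj₂ c∼y = _ , _ , _ , a∈R , c∈R , a≢c , y∈E , a∼y , c∼y
      ... | inj₁ _   | inj₂ b∼y | inj₂ c∼y = _ , _ , _ , b∈R , c∈R , b≢c , y∈E , b∼y , c∼y
      ... | inj₂ _   | inj₁ b∼x | inj₁ c∼x = _ , _ , _ , b∈R , c∈R , b≢c , x∈E , b∼x , c∼x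

    avoiding-pair-not-intersecting : 5 ≤ e H → ¬ Intersecting R
    avoiding-pair-not-intersecting 5≤e intersecting
      with a , b , c , a∈R , b∈R , c∈R , a≢b , a≢c , b≢c ← three-distinct R! (3≤|R| 5≤e)
      with s , s∈a , s∈b ← intersecting a∈R b∈R
      with star-or-triangle intersecting a∈R b∈R a≢b s∈a s∈b
    ... | inj₁ star
      with t , t′ , z , t∈R , t′∈R , t≢t′ , z∈E , l∈z , l′∈z
             ← two-leaves-on-common-edge star a∈R b∈R c∈R a≢b a≢c b≢c
      = no-triangle (star-sparse star) (R⊆E t∈R) (R⊆E t′∈R) z∈E t≢t′ (star t∈R) (star t′∈R) l∈z l′∈z
    ... | inj₂ (g , g∈R , q∈g , r∈g , R⊆abg) =
      no-triangle sparse (R⊆E a∈R) (R⊆E b∈R) (R⊆E g∈R) a≢b s∈a s∈b q∈g r∈g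
      where
      R-small : length R ≤ 3
      R-small = length-≤-of-⊆ _≟ᵉ_ R! R⊆abg
      sparse : e H ≤ suc (v H)
      sparse = ℕₚ.≤-trans e≤2+|R| (ℕₚ.≤-trans (ℕₚ.+-monoʳ-≤ 2 R-small) (s≤s 4≤v))

proposition2p9 : (H : Graph) → StrictlyTwoBalanced H → 5 ≤ e H →
    Σ _ (λ r → IsM₂ H r × 1ℚ < r) →
    (x y : Edge (n H)) → x ∈ edges H → y ∈ edges H →
    Σ (Edge (n H)) λ g → Σ (Edge (n H)) λ h →
      g ∈ edges H × ¬ (g ≡ x) × ¬ (g ≡ y) ×
      h ∈ edges H × ¬ (h ≡ x) × ¬ (h ≡ y) × Disjoint g h
proposition2p9 H sb 5≤e (r , r-is-m₂ , 1<r) x y x∈E y∈E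
  with disjoint-pair-or-intersecting (filter (avoids? x y) (edges H))
... | inj₁ (g , h , g∈R , h∈R , g∥h) =
  let g∈E , g≢x , g≢y = ∈-filter⁻ (avoids? x y) g∈R
      h∈E , h≢x , h≢y = ∈-filter⁻ (avoids? x y) h∈R
  in g , h , g∈E , g≢x , g≢y , h∈E , h≢x , h≢y , g∥h
... | inj₂ intersecting = ⊥-elim (avoiding-pair-not-intersecting x∈E y∈E 5≤e intersecting)
  where
  1<d₂ : 1ℚ < d₂ (v H) (e H)
  1<d₂ = subst (1ℚ <_) (strictly-balanced⇒m₂≡d₂ H sb r-is-m₂) 1<r
  open StrictlyBalanced H sb (dense⇒4≤v H 5≤e 1<d₂) (proj₂ (1<d₂⇒3≤v≤e (v H) (e H) 1<d₂))
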